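{- Let $X$ be a set, $\mathrm{F}(X)$ the free group on $X$ with inclusion $\iota : X\to\mathrm{F}(X)$. Then the map $\mathrm{F}(X)\text{ - }\mathrm{Set}\to X\text{ - }\mathrm{Set}$ sending $(A,\alpha)$, with $\alpha:\mathrm{F}(X)\to_{\mathrm{Grp}}\mathrm{Aut}(A)$, to $(A,\lambda x.\,\alpha(\iota\,x))$ (where $\alpha(\iota\,x)$ is seen as a function $A\to A$) is an embedding.
   Context: Homotopy type theory with univalence. For a group $G$, $G\text{ - }\mathrm{Set} := \Sigma(A:\mathrm{Set}).(G\to_{\mathrm{Grp}}\mathrm{Aut}(A))$ with $\mathrm{Aut}(A)=(A\simeq A)$; $X\text{ - }\mathrm{Set} := \Sigma(A:\mathrm{Set}).(X\to(A\to A))$. A map $g:B\to C$ is an embedding when for all $b,b':B$ the induced map $(b=b')\to(g\,b=g\,b')$ is an equivalence. -}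

{-# OPTIONS --without-K #-}
module Defs where

open import Level using (Level; _⊔_; suc; Setω)
open import Data.Product using (Σ; Σ-syntax; _×_; _,_; proj₁; proj₂)
open import Function using (_∘_; id)
open import Relation.Binary.PropositionalEquality using (_≡_; refl; cong; trans)

private variable ℓ ℓ' ℓ'' : Level

isProp : Set ℓ → Set ℓ
isProp A = (x y : A) → x ≡ y

isSet : Set ℓ → Set ℓ
isSet A = (x y : A) → isProp (x ≡ y)

hSet : (ℓ : Level) → Set (suc ℓ)
hSet ℓ = Σ (Set ℓ) isSet

⟨_⟩ : hSet ℓ → Set ℓ
⟨ A ⟩ = proj₁ A

isEquiv : {A : Set ℓ} {B : Set ℓ'} → (A → B) → Set (ℓ ⊔ ℓ')
isEquiv {A = A} {B = B} f =
  (Σ (B → A) λ s → (b : B) → f (s b) ≡ b) × (Σ (B → A) λ r → (a : A) → r (f a) ≡ a)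

_≃_ : Set ℓ → Set ℓ' → Set (ℓ ⊔ ℓ')
A ≃ B = Σ (A → B) isEquiv

idEquiv : (A : Set ℓ) → A ≃ A
idEquiv A = id , ((id , λ _ → refl) , (id , λ _ → refl))

_∘≃_ : {A : Set ℓ} {B : Set ℓ'} {C : Set ℓ''} → B ≃ C → A ≃ B → A ≃ C
(g , (sg , εg) , (rg , ηg)) ∘≃ (f , (sf , εf) , (rf , ηf)) =
  g ∘ f ,
  ((sf ∘ sg , λ c → trans (cong g (εf (sg c))) (εg c)) ,
   (rf ∘ rg , λ a → trans (cong rf (ηg (f a))) (ηf a)))

isEmbedding : {A : Set ℓ} {B : Set ℓ'} → (A → B) → Set (ℓ ⊔ ℓ')
isEmbedding {A = A} f = (b b' : A) → isEquiv (cong f {b} {b'})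

idtoeqv : {A B : Set ℓ} → A ≡ B → A ≃ B
idtoeqv {A = A} refl = idEquiv A

Univalence : (ℓ : Level) → Set (suc ℓ)
Univalence ℓ = (A B : Set ℓ) → isEquiv (idtoeqv {A = A} {B = B})

happly : {A : Set ℓ} {B : A → Set ℓ'} {f g : (a : A) → B a} → f ≡ g → (a : A) → f a ≡ g a
happly refl a = refl

FunExt : (ℓ ℓ' : Level) → Set (suc (ℓ ⊔ ℓ'))
FunExt ℓ ℓ' = {A : Set ℓ} {B : A → Set ℓ'} (f g : (a : A) → B a) → isEquiv (happly {f = f} {g = g})

record Group (ℓ : Level) : Set (suc ℓ) where
  field
    Carrier : Set ℓ
    is-set  : isSet Carrier
    _·_     : Carrier → Carrier → Carrier
    e       : Carrier
    inv     : Carrier → Carrier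
    assoc   : (x y z : Carrier) → (x · y) · z ≡ x · (y · z)
    idˡ     : (x : Carrier) → e · x ≡ x
    idʳ     : (x : Carrier) → x · e ≡ x
    invˡ    : (x : Carrier) → inv x · x ≡ e
    invʳ    : (x : Carrier) → x · inv x ≡ e

open Group public

-- group homomorphisms (preservation of multiplication; unit and inverses follow)
Hom : Group ℓ → Group ℓ' → Set (ℓ ⊔ ℓ')
Hom G H = Σ (Carrier G → Carrier H) λ f →
  (x y : Carrier G) → f (_·_ G x y) ≡ _·_ H (f x) (f y)

-- Homomorphisms G →Grp Aut(A), written out with Aut(A) = (A ≃ A) under composition
HomToAut : Group ℓ → Set ℓ' → Set (ℓ ⊔ ℓ')
HomToAut G A = Σ (Carrier G → A ≃ A) λ α →
  (x y : Carrier G) → α (_·_ G x y) ≡ α x ∘≃ α y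

-- Free group on a set X, characterised by its universal property:
-- restriction along ι, Hom(F, G) → (X → G), is an equivalence for every group G.
record FreeGroupOn {ℓ : Level} (X : hSet ℓ) : Setω where
  field
    F   : Group ℓ
    ι   : ⟨ X ⟩ → Carrier F
    univ : ∀ {ℓ'} (G : Group ℓ') → isEquiv (λ (φ : Hom F G) → proj₁ φ ∘ ι)

open FreeGroupOn public

_-Set[_] : Group ℓ → (ℓ' : Level) → Set (ℓ ⊔ suc ℓ')
G -Set[ ℓ' ] = Σ (hSet ℓ') λ A → HomToAut G ⟨ A ⟩

_-TSet[_] : Set ℓ → (ℓ' : Level) → Set (ℓ ⊔ suc ℓ')
X -TSet[ ℓ' ] = Σ (hSet ℓ') λ A → X → (⟨ A ⟩ → ⟨ A ⟩)

restrict : {ℓ ℓ' : Level} {X : hSet ℓ} (FX : FreeGroupOn X) →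
           F FX -Set[ ℓ' ] → ⟨ X ⟩ -TSet[ ℓ' ]
restrict FX (A , α , _) = A , λ x → proj₁ (α (ι FX x))

{-# OPTIONS --without-K #-}
-- The map restrict leaves the carrier unchanged, so it is the total map of a
-- fibrewise map over hSet, and it suffices that each fibre map
-- Hom(F(X), Aut A) → (X → A → A) is an embedding. That map factors as
-- restriction along ι, an equivalence by the universal property of F(X),
-- followed by postcomposition with the underlying-function map
-- (A ≃ A) → (A → A), an embedding because being an equivalence is a
-- proposition when A is a set. Each embedding arises from the weaker property
-- that cong f has a section, which is preserved by composition,
-- postcomposition and total maps.
module Submission where

open import Level using (Level)
open import Defs
open import Data.Product using (Σ; _,_; proj₁; proj₂; map₂)
open import Data.Product.Properties using (Σ-≡,≡→≡; Σ-≡,≡←≡; Σ-≡,≡↔≡)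
open import Function using (_∘_; Inverse)
open import Relation.Binary.PropositionalEquality
  using (_≡_; refl; sym; trans; cong; cong₂; subst; module ≡-Reasoning)
open import Relation.Binary.PropositionalEquality.Properties
  using (trans-symˡ; trans-symʳ; cong-∘)

private variable
  a b c : Level
  A B C : Set a

module IsEquiv {f : A → B} (e : isEquiv f) where
  inverse : B → A
  inverse = proj₁ (proj₁ e)

  inverseʳ : (y : B) → f (inverse y) ≡ y
  inverseʳ = proj₂ (proj₁ e)

  inverseˡ : (x : A) → inverse (f x) ≡ x
  inverseˡ x = trans (sym (η (inverse (f x)))) (trans (cong r (inverseʳ (f x))) (η x))
    where
    r = proj₁ (proj₂ e)
    η = proj₂ (proj₂ e)

  injective : {x y : A} → f x ≡ f y → x ≡ y
  injective {x} {y} q = trans (sym (inverseˡ x)) (trans (cong inverse q) (inverseˡ y))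

HasCongSection : (A → B) → Set _
HasCongSection {A = A} f = (x y : A) (q : f x ≡ f y) → Σ (x ≡ y) λ p → cong f p ≡ q

HasCongRetraction : (A → B) → Set _
HasCongRetraction {A = A} f =
  (x y : A) → Σ (f x ≡ f y → x ≡ y) λ r → (p : x ≡ y) → r (cong f p) ≡ p

module _ {f : A → B} where

  hasCongRetraction⇒cong-injective : HasCongRetraction f →
    {x y : A} {p q : x ≡ y} → cong f p ≡ cong f q → p ≡ q
  hasCongRetraction⇒cong-injective ret {x} {y} {p} {q} fp≡fq = begin
    p               ≡⟨ sym (retract p) ⟩
    r (cong f p)    ≡⟨ cong r fp≡fq ⟩
    r (cong f q)    ≡⟨ retract q ⟩
    q               ∎
    where
    open ≡-Reasoning
    r = proj₁ (ret x y)
    retract = proj₂ (ret x y)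

  hasCongRetraction⇒isSet : HasCongRetraction f → isSet B → isSet A
  hasCongRetraction⇒isSet ret setB x y p q =
    hasCongRetraction⇒cong-injective ret (setB (f x) (f y) (cong f p) (cong f q))

  -- Correcting the section at q by the section at refl makes it a retraction.
  hasCongSection⇒hasCongRetraction : HasCongSection f → HasCongRetraction f
  hasCongSection⇒hasCongRetraction sec x y = r , retract
    where
    r : {x y : A} → f x ≡ f y → x ≡ y
    r {x} {y} q = trans (proj₁ (sec x y q)) (sym (proj₁ (sec y y refl)))
    retract : {x y : A} (p : x ≡ y) → r (cong f p) ≡ p
    retract {x} refl = trans-symʳ (proj₁ (sec x x refl))

  hasCongSection⇒isEmbedding : HasCongSection f → isEmbedding f
  hasCongSection⇒isEmbedding sec x y =
    ((λ q → proj₁ (sec x y q)) , (λ q → proj₂ (sec x y q))) ,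
    hasCongSection⇒hasCongRetraction sec x y

  module _ (g : B → A) (η : (x : A) → g (f x) ≡ x) where

    leftInverse⇒hasCongRetraction : HasCongRetraction f
    leftInverse⇒hasCongRetraction x y = r , retract
      where
      r : {x y : A} → f x ≡ f y → x ≡ y
      r {x} {y} q = trans (sym (η x)) (trans (cong g q) (η y))
      retract : {x y : A} (p : x ≡ y) → r (cong f p) ≡ p
      retract {x} refl = trans-symˡ (η x)

    cong-leftInverse : {x y : A} (p : x ≡ y) →
      cong (g ∘ f) p ≡ trans (η x) (trans p (sym (η y)))
    cong-leftInverse {x} refl = sym (trans-symʳ (η x))

-- The retraction of cong f coming from g is also a section, since cong g is injective.
quasiInverse⇒hasCongSection : {f : A → B} (g : B → A) →
  ((x : A) → g (f x) ≡ x) → ((y : B) → f (g y) ≡ y) → HasCongSection f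
quasiInverse⇒hasCongSection {f = f} g η ε x y q = p , cong-g-injective gfp≡gq
  where
  open ≡-Reasoning
  p = proj₁ (leftInverse⇒hasCongRetraction g η x y) q

  cancel : {x₀ x y₀ y : A} (u : x₀ ≡ x) (v : x₀ ≡ y₀) (w : y₀ ≡ y) →
    trans u (trans (trans (sym u) (trans v w)) (sym w)) ≡ v
  cancel refl refl refl = refl

  gfp≡gq : cong g (cong f p) ≡ cong g q
  gfp≡gq = begin
    cong g (cong f p)                          ≡⟨ sym (cong-∘ p) ⟩
    cong (g ∘ f) p                             ≡⟨ cong-leftInverse g η p ⟩
    trans (η x) (trans p (sym (η y)))          ≡⟨ cancel (η x) (cong g q) (η y) ⟩
    cong g q                                   ∎

  cong-g-injective = hasCongRetraction⇒cong-injective (leftInverse⇒hasCongRetraction f ε)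

isEquiv⇒hasCongSection : {f : A → B} → isEquiv f → HasCongSection f
isEquiv⇒hasCongSection e = quasiInverse⇒hasCongSection inverse inverseˡ inverseʳ
  where open IsEquiv e

hasCongSection-∘ : {g : B → C} {f : A → B} →
  HasCongSection g → HasCongSection f → HasCongSection (g ∘ f)
hasCongSection-∘ {g = g} {f} secg secf x y q =
  let (p , fp≡q′) = secg (f x) (f y) q
      (p′ , fp′≡p) = secf x y p
  in p′ , trans (cong-∘ p′) (trans (cong (cong g) fp′≡p) fp≡q′)

module _ {P : A → Set b} where

  cong-proj₁-Σ-≡,≡→≡ : {x x′ : A} {u : P x} {u′ : P x′} (e : x ≡ x′) (k : subst P e u ≡ u′) →
    cong proj₁ (Σ-≡,≡→≡ {p₁ = x , u} {p₂ = x′ , u′} (e , k)) ≡ e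
  cong-proj₁-Σ-≡,≡→≡ refl refl = refl

  hasCongSection-proj₁ : ((x : A) → isProp (P x)) → HasCongSection (proj₁ {B = P})
  hasCongSection-proj₁ propP (x , u) (x′ , u′) e =
    Σ-≡,≡→≡ (e , k) , cong-proj₁-Σ-≡,≡→≡ e k
    where k = propP x′ _ _

  module _ {Q : A → Set c} (f : (x : A) → P x → Q x) where

    total : Σ A P → Σ A Q
    total = map₂ (λ {x} → f x)

    private
      over-refl : (x : A) {u : P x} {v : Q x} (k : f x u ≡ v) →
        Σ-≡,≡→≡ {B = Q} (refl , k) ≡ cong (x ,_) k
      over-refl x refl = refl

      liftOver : {x : A} → HasCongSection (f x) → {u : P x} {x′ : A} {u′ : P x′}
        (e : x ≡ x′) (k : subst Q e (f x u) ≡ f x′ u′) →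
        Σ ((x , u) ≡ (x′ , u′)) λ p → cong total p ≡ Σ-≡,≡→≡ {B = Q} (e , k)
      liftOver {x} sec {u} {u′ = u′} refl k = cong (x ,_) p , (begin
        cong total (cong (x ,_) p)      ≡⟨ sym (cong-∘ p) ⟩
        cong ((x ,_) ∘ f x) p           ≡⟨ cong-∘ p ⟩
        cong (x ,_) (cong (f x) p)      ≡⟨ cong (cong (x ,_)) fp≡k ⟩
        cong (x ,_) k                   ≡⟨ sym (over-refl x k) ⟩
        Σ-≡,≡→≡ {B = Q} (refl , k)      ∎)
        where
        open ≡-Reasoning
        p = proj₁ (sec u u′ k)
        fp≡k = proj₂ (sec u u′ k)

    hasCongSection-total : ((x : A) → HasCongSection (f x)) → HasCongSection total
    hasCongSection-total sec (x , u) (x′ , u′) q =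
      let (e , k) = Σ-≡,≡←≡ q
          (p , tp≡ek) = liftOver (sec x) e k
      in p , trans tp≡ek (Inverse.strictlyInverseˡ Σ-≡,≡↔≡ q)

module FunExtProperties (fe : FunExt a b) where

  funext : {A : Set a} {B : A → Set b} {f g : (x : A) → B x} → ((x : A) → f x ≡ g x) → f ≡ g
  funext {f = f} {g} = IsEquiv.inverse (fe f g)

  happly-funext : {A : Set a} {B : A → Set b} {f g : (x : A) → B x}
    (H : (x : A) → f x ≡ g x) → happly (funext H) ≡ H
  happly-funext {f = f} {g} = IsEquiv.inverseʳ (fe f g)

  happly-injective : {A : Set a} {B : A → Set b} {f g : (x : A) → B x} {p q : f ≡ g} →
    happly p ≡ happly q → p ≡ q
  happly-injective {f = f} {g} = IsEquiv.injective (fe f g)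

  Π-isProp : {A : Set a} {B : A → Set b} → ((x : A) → isProp (B x)) → isProp ((x : A) → B x)
  Π-isProp propB u v = funext (λ x → propB x (u x) (v x))

  →-isSet : {A : Set a} {B : Set b} → isSet B → isSet (A → B)
  →-isSet setB f g p q = happly-injective (Π-isProp (λ x → setB (f x) (g x)) (happly p) (happly q))

  happly-cong-post∘ : {A : Set a} {B C : Set b} (k : B → C) {g g′ : A → B} (p : g ≡ g′) →
    happly (cong (k ∘_) p) ≡ (λ x → cong k (happly p x))
  happly-cong-post∘ k refl = refl

  hasCongSection-post∘ : {A : Set a} {B C : Set b} {k : B → C} →
    HasCongSection k → HasCongSection {A = A → B} (k ∘_)
  hasCongSection-post∘ {k = k} sec g g′ q = p , happly-injective (begin
    happly (cong (k ∘_) p)                  ≡⟨ happly-cong-post∘ k p ⟩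
    (λ x → cong k (happly p x))             ≡⟨ cong (λ H x → cong k (H x)) (happly-funext pointwise) ⟩
    (λ x → cong k (pointwise x))            ≡⟨ funext (λ x → proj₂ (sec (g x) (g′ x) (happly q x))) ⟩
    happly q                                ∎)
    where
    open ≡-Reasoning
    pointwise = λ x → proj₁ (sec (g x) (g′ x) (happly q x))
    p = funext pointwise

module Automorphisms {ℓ : Level} (fe : FunExt ℓ ℓ) where
  open FunExtProperties fe

  isEquiv-isProp : {A B : Set ℓ} → isSet A → isSet B → (f : A → B) → isProp (isEquiv f)
  isEquiv-isProp setA setB f ((s , ε) , (r , η)) ((s′ , ε′) , (r′ , η′)) =
    cong₂ _,_ (Σ-≡,≡→≡ (funext s≗s′ , Π-isProp (λ y → setB _ _) _ _))
              (Σ-≡,≡→≡ (funext r≗r′ , Π-isProp (λ x → setA _ _) _ _))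
    where
    r≗s′ : ∀ y → r y ≡ s′ y
    r≗s′ y = trans (cong r (sym (ε′ y))) (η (s′ y))
    s≗s′ : ∀ y → s y ≡ s′ y
    s≗s′ y = trans (sym (η (s y))) (trans (cong r (ε y)) (r≗s′ y))
    r≗r′ : ∀ y → r y ≡ r′ y
    r≗r′ y = trans (r≗s′ y) (trans (sym (η′ (s′ y))) (cong r′ (ε′ y)))

  module _ (A : hSet ℓ) where

    hasCongSection-underlying : HasCongSection (proj₁ {B = isEquiv {A = ⟨ A ⟩} {B = ⟨ A ⟩}})
    hasCongSection-underlying = hasCongSection-proj₁ (isEquiv-isProp (proj₂ A) (proj₂ A))

    ≃-ext : {u v : ⟨ A ⟩ ≃ ⟨ A ⟩} → proj₁ u ≡ proj₁ v → u ≡ v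
    ≃-ext {u} {v} q = proj₁ (hasCongSection-underlying u v q)

    ≃-isSet : isSet (⟨ A ⟩ ≃ ⟨ A ⟩)
    ≃-isSet = hasCongRetraction⇒isSet
      (hasCongSection⇒hasCongRetraction hasCongSection-underlying) (→-isSet (proj₂ A))

    ≃-sym : ⟨ A ⟩ ≃ ⟨ A ⟩ → ⟨ A ⟩ ≃ ⟨ A ⟩
    ≃-sym (f , e) = inverse , (f , inverseˡ) , (f , inverseʳ)
      where open IsEquiv e

    Aut : Group ℓ
    Aut = record
      { Carrier = ⟨ A ⟩ ≃ ⟨ A ⟩
      ; is-set  = ≃-isSet
      ; _·_     = _∘≃_
      ; e       = idEquiv ⟨ A ⟩
      ; inv     = ≃-sym
      ; assoc   = λ _ _ _ → ≃-ext refl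
      ; idˡ     = λ _ → ≃-ext refl
      ; idʳ     = λ _ → ≃-ext refl
      ; invˡ    = λ (_ , e) → ≃-ext (funext (IsEquiv.inverseˡ e))
      ; invʳ    = λ (_ , e) → ≃-ext (funext (IsEquiv.inverseʳ e))
      }

mainTheorem13 : {ℓ ℓ' : Level} → Univalence ℓ' → FunExt ℓ ℓ' → FunExt ℓ' ℓ' →
    (X : hSet ℓ) (FX : FreeGroupOn X) → isEmbedding (restrict {ℓ' = ℓ'} FX)
mainTheorem13 {ℓ' = ℓ'} _ feX feA X FX =
  hasCongSection⇒isEmbedding (hasCongSection-total actions hasCongSection-actions)
  where
  open Automorphisms feA

  actions : (A : hSet ℓ') → HomToAut (F FX) ⟨ A ⟩ → ⟨ X ⟩ → ⟨ A ⟩ → ⟨ A ⟩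
  actions A α x = proj₁ (proj₁ α (ι FX x))

  hasCongSection-actions : (A : hSet ℓ') → HasCongSection (actions A)
  hasCongSection-actions A =
    hasCongSection-∘ (FunExtProperties.hasCongSection-post∘ feX (hasCongSection-underlying A))
                     (isEquiv⇒hasCongSection (univ FX (Aut A)))
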